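{- Let $X=\{0,1\}$ and $c\geq 1$. Let $\widetilde{K}_{1,01}(c)$ be the set of words $w\in X^c$ such that the sequence $(1,01,w)$ is not a code, and let $J_{1,01}(c)$ be the set of words $w\in X^c$ which do not contain two consecutive $0$'s. Then $\widetilde{K}_{1,01}(c)=J_{1,01}(c)$, and $|\widetilde{K}_{1,01}(c)|=F_{c+2}$, where $F_n=\frac{(1+\sqrt5)^n-(1-\sqrt5)^n}{2^n\sqrt5}$ is the $n$-th Fibonacci number.
   Context: A code over $X$ is a finite sequence $(u_1,\ldots,u_m)$ of words over $X$ such that every word $w$ over $X$ has at most one factorization into its terms: if $w=u_{i_1}\cdots u_{i_l}=u_{j_1}\cdots u_{j_{l'}}$ with $l,l'\geq 1$, then $l=l'$ and $i_t=j_t$ for all $t$. -}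

module Defs where

open import Data.Bool using (Bool; true; false)
open import Data.Nat using (ℕ; zero; suc; _+_)
open import Data.Fin using (Fin)
open import Data.List using (List; []; _∷_; map; concat)
open import Relation.Binary.PropositionalEquality using (_≡_)
open import Relation.Nullary using (¬_)
open import Data.Unit using (⊤)
open import Data.Empty using (⊥)

-- The alphabet X = {0,1}: false = 0, true = 1.
Word : Set
Word = List Bool

IsCode : {m : ℕ} → (Fin m → Word) → Set
IsCode {m} u = (is js : List (Fin m)) → ¬ (is ≡ []) → ¬ (js ≡ []) →
               concat (map u is) ≡ concat (map u js) → is ≡ js

seq-1-01 : Word → Fin 3 → Word
seq-1-01 w Fin.zero = true ∷ []
seq-1-01 w (Fin.suc Fin.zero) = false ∷ true ∷ []
seq-1-01 w (Fin.suc (Fin.suc Fin.zero)) = w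

NoDoubleZero : Word → Set
NoDoubleZero [] = ⊤
NoDoubleZero (false ∷ false ∷ _) = ⊥
NoDoubleZero (_ ∷ w) = NoDoubleZero w

-- Fibonacci numbers F_0 = 0, F_1 = 1, F_{n+2} = F_{n+1} + F_n
-- (these agree with Binet's formula in the statement).
fib : ℕ → ℕ
fib 0 = 0
fib 1 = 1
fib (suc (suc n)) = fib (suc n) + fib n

{-# OPTIONS --safe #-}
-- If w has no factor 00, then w1 also factors over {1, 01}, so the word w·1 has two
-- factorizations.  If w contains 00, compare positions of the first occurrence of 00:
-- in a concatenation of factors it lies at least that far in as in w, with equality
-- exactly when the concatenation begins with w, because 1 and 01 contain no 00 and end
-- in 1.  So two factorizations of the same word begin with the same factor, and
-- cancelling it shows that (1, 01, w) is a code.  Words of length n + 2 without 00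
-- begin with 1 or with 01, which gives the Fibonacci recursion for their number.
module Submission where

open import Defs
open import Data.Bool using (true; false)
open import Data.Empty using (⊥-elim)
open import Data.Fin using (Fin)
import Data.Fin as Fin
open import Data.List using (List; []; _∷_; _++_; map; concat; length)
open import Data.List.Membership.Propositional using (_∈_)
open import Data.List.Membership.Propositional.Properties using (∈-map⁻; ∈-map⁺; ∈-++⁻; ∈-++⁺ˡ; ∈-++⁺ʳ)
open import Data.List.Properties using (++-cancelˡ; ∷-injectiveʳ; length-++; length-map)
open import Data.List.Relation.Unary.Any using (here; there)
open import Data.List.Relation.Unary.All using ([]; _∷_)
open import Data.List.Relation.Unary.AllPairs using ([]; _∷_)
open import Data.List.Relation.Unary.Unique.Propositional using (Unique)
import Data.List.Relation.Unary.Unique.Propositional.Properties as Unique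
open import Data.Nat using (ℕ; suc; _≥_; _+_; _≤_; _<_; s≤s)
open import Data.Nat.Properties using (≤-refl; m≤n⇒m≤1+n; <⇒≢)
open import Data.Product using (Σ; _×_; _,_; map₁; map₂)
open import Data.Sum using (inj₁; inj₂)
open import Data.Unit using (tt)
open import Function.Bundles using (_⇔_; mk⇔; Equivalence)
open import Relation.Nullary using (¬_; yes; no)
open import Relation.Unary using (Decidable)
open import Relation.Binary.PropositionalEquality using (_≡_; _≢_; refl; sym; trans; cong; cong₂; subst)

pattern i-1 = Fin.zero
pattern i-01 = Fin.suc Fin.zero
pattern i-w = Fin.suc (Fin.suc Fin.zero)

concatFactors : Word → List (Fin 3) → Word
concatFactors w ks = concat (map (seq-1-01 w) ks)

noDoubleZero? : Decidable NoDoubleZero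
noDoubleZero? [] = yes tt
noDoubleZero? (false ∷ false ∷ w) = no (λ ())
noDoubleZero? (false ∷ []) = yes tt
noDoubleZero? (false ∷ true ∷ w) = noDoubleZero? w
noDoubleZero? (true ∷ w) = noDoubleZero? w

NoDoubleZero-++⁻ˡ : (v r : Word) → NoDoubleZero (v ++ r) → NoDoubleZero v
NoDoubleZero-++⁻ˡ [] r _ = tt
NoDoubleZero-++⁻ˡ (false ∷ false ∷ v) r ()
NoDoubleZero-++⁻ˡ (false ∷ []) r _ = tt
NoDoubleZero-++⁻ˡ (false ∷ true ∷ v) r p = NoDoubleZero-++⁻ˡ v r p
NoDoubleZero-++⁻ˡ (true ∷ v) r p = NoDoubleZero-++⁻ˡ v r p

-- Meaningful only when v contains 00; the values on words without 00 are junk.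
firstDoubleZero : Word → ℕ
firstDoubleZero [] = 0
firstDoubleZero (false ∷ false ∷ v) = 0
firstDoubleZero (false ∷ []) = 1
firstDoubleZero (false ∷ true ∷ v) = suc (suc (firstDoubleZero v))
firstDoubleZero (true ∷ v) = suc (firstDoubleZero v)

firstDoubleZero-++ : (v r : Word) → ¬ NoDoubleZero v → firstDoubleZero (v ++ r) ≡ firstDoubleZero v
firstDoubleZero-++ [] r h = ⊥-elim (h tt)
firstDoubleZero-++ (false ∷ false ∷ v) r h = refl
firstDoubleZero-++ (false ∷ []) r h = ⊥-elim (h tt)
firstDoubleZero-++ (false ∷ true ∷ v) r h = cong (λ k → suc (suc k)) (firstDoubleZero-++ v r h)
firstDoubleZero-++ (true ∷ v) r h = cong suc (firstDoubleZero-++ v r h)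

module WithDoubleZero (w : Word) (w-has-00 : ¬ NoDoubleZero w) where

  concatFactors-w∷-has-00 : (ks : List (Fin 3)) → ¬ NoDoubleZero (concatFactors w (i-w ∷ ks))
  concatFactors-w∷-has-00 ks p = w-has-00 (NoDoubleZero-++⁻ˡ w (concatFactors w ks) p)

  firstDoubleZero-w∷ : (ks : List (Fin 3)) →
    firstDoubleZero (concatFactors w (i-w ∷ ks)) ≡ firstDoubleZero w
  firstDoubleZero-w∷ ks = firstDoubleZero-++ w (concatFactors w ks) w-has-00

  firstDoubleZero-concatFactors : (ks : List (Fin 3)) → ¬ NoDoubleZero (concatFactors w ks) →
    firstDoubleZero w ≤ firstDoubleZero (concatFactors w ks)
  firstDoubleZero-concatFactors [] h = ⊥-elim (h tt)
  firstDoubleZero-concatFactors (i-1 ∷ ks) h = m≤n⇒m≤1+n (firstDoubleZero-concatFactors ks h)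
  firstDoubleZero-concatFactors (i-01 ∷ ks) h =
    m≤n⇒m≤1+n (m≤n⇒m≤1+n (firstDoubleZero-concatFactors ks h))
  firstDoubleZero-concatFactors (i-w ∷ ks) h
    rewrite firstDoubleZero-w∷ ks = ≤-refl

  firstDoubleZero-letter∷ : (k : Fin 3) (ks : List (Fin 3)) → k ≢ i-w →
    ¬ NoDoubleZero (concatFactors w (k ∷ ks)) →
    firstDoubleZero w < firstDoubleZero (concatFactors w (k ∷ ks))
  firstDoubleZero-letter∷ i-1 ks _ h = s≤s (firstDoubleZero-concatFactors ks h)
  firstDoubleZero-letter∷ i-01 ks _ h = s≤s (m≤n⇒m≤1+n (firstDoubleZero-concatFactors ks h))
  firstDoubleZero-letter∷ i-w ks k≢w _ = ⊥-elim (k≢w refl)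

  w∷-head : (is : List (Fin 3)) (j : Fin 3) (js : List (Fin 3)) →
    concatFactors w (i-w ∷ is) ≡ concatFactors w (j ∷ js) → j ≡ i-w
  w∷-head is j js e with j Fin.≟ i-w
  ... | yes j≡w = j≡w
  ... | no j≢w = ⊥-elim (<⇒≢ (firstDoubleZero-letter∷ j js j≢w j∷js-has-00) same-position)
    where
    j∷js-has-00 : ¬ NoDoubleZero (concatFactors w (j ∷ js))
    j∷js-has-00 = subst (λ v → ¬ NoDoubleZero v) e (concatFactors-w∷-has-00 is)
    same-position : firstDoubleZero w ≡ firstDoubleZero (concatFactors w (j ∷ js))
    same-position = trans (sym (firstDoubleZero-w∷ is)) (cong firstDoubleZero e)

  concatFactors-head : (i : Fin 3) (is : List (Fin 3)) (j : Fin 3) (js : List (Fin 3)) →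
    concatFactors w (i ∷ is) ≡ concatFactors w (j ∷ js) → i ≡ j
  concatFactors-head i-w is j js e = sym (w∷-head is j js e)
  concatFactors-head i is i-w js e = w∷-head js i is (sym e)
  concatFactors-head i-1 is i-1 js e = refl
  concatFactors-head i-1 is i-01 js ()
  concatFactors-head i-01 is i-1 js ()
  concatFactors-head i-01 is i-01 js e = refl

  concatFactors-∷≢[] : (i : Fin 3) (is : List (Fin 3)) → concatFactors w (i ∷ is) ≢ []
  concatFactors-∷≢[] i-1 is ()
  concatFactors-∷≢[] i-01 is ()
  concatFactors-∷≢[] i-w is e = concatFactors-w∷-has-00 is (subst NoDoubleZero (sym e) tt)

  concatFactors-injective : (is js : List (Fin 3)) →
    concatFactors w is ≡ concatFactors w js → is ≡ js
  concatFactors-injective [] [] e = refl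
  concatFactors-injective [] (j ∷ js) e = ⊥-elim (concatFactors-∷≢[] j js (sym e))
  concatFactors-injective (i ∷ is) [] e = ⊥-elim (concatFactors-∷≢[] i is e)
  concatFactors-injective (i ∷ is) (j ∷ js) e with concatFactors-head i is j js e
  ... | refl = cong (i ∷_) (concatFactors-injective is js
                 (++-cancelˡ (seq-1-01 w i) (concatFactors w is) (concatFactors w js) e))

  isCode : IsCode (seq-1-01 w)
  isCode is js _ _ = concatFactors-injective is js

letterFactorization : (v : Word) → NoDoubleZero v → List (Fin 3)
letterFactorization [] _ = i-1 ∷ []
letterFactorization (true ∷ v) p = i-1 ∷ letterFactorization v p
letterFactorization (false ∷ []) _ = i-01 ∷ []
letterFactorization (false ∷ true ∷ v) p = i-01 ∷ letterFactorization v p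

concatFactors-letterFactorization : (w v : Word) (p : NoDoubleZero v) →
  concatFactors w (letterFactorization v p) ≡ v ++ true ∷ []
concatFactors-letterFactorization w [] p = refl
concatFactors-letterFactorization w (true ∷ v) p = cong (true ∷_) (concatFactors-letterFactorization w v p)
concatFactors-letterFactorization w (false ∷ []) p = refl
concatFactors-letterFactorization w (false ∷ true ∷ v) p =
  cong (λ r → false ∷ true ∷ r) (concatFactors-letterFactorization w v p)

letterFactorization-≢[] : (v : Word) (p : NoDoubleZero v) → letterFactorization v p ≢ []
letterFactorization-≢[] [] p ()
letterFactorization-≢[] (true ∷ v) p ()
letterFactorization-≢[] (false ∷ []) p ()
letterFactorization-≢[] (false ∷ true ∷ v) p ()

w∷≢letterFactorization : (ks : List (Fin 3)) (v : Word) (p : NoDoubleZero v) →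
  i-w ∷ ks ≢ letterFactorization v p
w∷≢letterFactorization ks [] p ()
w∷≢letterFactorization ks (true ∷ v) p ()
w∷≢letterFactorization ks (false ∷ []) p ()
w∷≢letterFactorization ks (false ∷ true ∷ v) p ()

NoDoubleZero⇒¬IsCode : (w : Word) → NoDoubleZero w → ¬ IsCode (seq-1-01 w)
NoDoubleZero⇒¬IsCode w p code =
  w∷≢letterFactorization (i-1 ∷ []) w p
    (code (i-w ∷ i-1 ∷ []) (letterFactorization w p) (λ ()) (letterFactorization-≢[] w p)
      (sym (concatFactors-letterFactorization w w p)))

¬IsCode⇔NoDoubleZero : (w : Word) → (¬ IsCode (seq-1-01 w)) ⇔ NoDoubleZero w
¬IsCode⇔NoDoubleZero w = mk⇔ to (NoDoubleZero⇒¬IsCode w)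
  where
  to : ¬ IsCode (seq-1-01 w) → NoDoubleZero w
  to ¬code with noDoubleZero? w
  ... | yes p = p
  ... | no ¬p = ⊥-elim (¬code (WithDoubleZero.isCode w ¬p))

noDoubleZeroWords : ℕ → List Word
noDoubleZeroWords 0 = [] ∷ []
noDoubleZeroWords 1 = (false ∷ []) ∷ (true ∷ []) ∷ []
noDoubleZeroWords (suc (suc n)) =
  map (true ∷_) (noDoubleZeroWords (suc n)) ++ map (λ v → false ∷ true ∷ v) (noDoubleZeroWords n)

∈-noDoubleZeroWords⁻ : (n : ℕ) (v : Word) → v ∈ noDoubleZeroWords n → length v ≡ n × NoDoubleZero v
∈-noDoubleZeroWords⁻ 0 _ (here refl) = refl , tt
∈-noDoubleZeroWords⁻ 1 _ (here refl) = refl , tt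
∈-noDoubleZeroWords⁻ 1 _ (there (here refl)) = refl , tt
∈-noDoubleZeroWords⁻ (suc (suc n)) v m with ∈-++⁻ (map (true ∷_) (noDoubleZeroWords (suc n))) m
... | inj₁ m₁ with ∈-map⁻ (true ∷_) m₁
...   | u , u∈ , refl = map₁ (cong suc) (∈-noDoubleZeroWords⁻ (suc n) u u∈)
∈-noDoubleZeroWords⁻ (suc (suc n)) v m | inj₂ m₀₁ with ∈-map⁻ (λ u → false ∷ true ∷ u) m₀₁
...   | u , u∈ , refl = map₁ (cong (λ k → suc (suc k))) (∈-noDoubleZeroWords⁻ n u u∈)

∈-noDoubleZeroWords⁺ : (v : Word) → NoDoubleZero v → v ∈ noDoubleZeroWords (length v)
∈-noDoubleZeroWords⁺ [] p = here refl
∈-noDoubleZeroWords⁺ (false ∷ []) p = here refl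
∈-noDoubleZeroWords⁺ (true ∷ []) p = there (here refl)
∈-noDoubleZeroWords⁺ (true ∷ b ∷ v) p = ∈-++⁺ˡ (∈-map⁺ (true ∷_) (∈-noDoubleZeroWords⁺ (b ∷ v) p))
∈-noDoubleZeroWords⁺ (false ∷ true ∷ v) p =
  ∈-++⁺ʳ (map (true ∷_) (noDoubleZeroWords (suc (length v))))
    (∈-map⁺ (λ u → false ∷ true ∷ u) (∈-noDoubleZeroWords⁺ v p))

∈-noDoubleZeroWords⇔ : (n : ℕ) (v : Word) → (v ∈ noDoubleZeroWords n) ⇔ (length v ≡ n × NoDoubleZero v)
∈-noDoubleZeroWords⇔ n v = mk⇔ (∈-noDoubleZeroWords⁻ n v) from
  where
  from : length v ≡ n × NoDoubleZero v → v ∈ noDoubleZeroWords n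
  from (refl , p) = ∈-noDoubleZeroWords⁺ v p

noDoubleZeroWords-unique : (n : ℕ) → Unique (noDoubleZeroWords n)
noDoubleZeroWords-unique 0 = [] ∷ []
noDoubleZeroWords-unique 1 = ((λ ()) ∷ []) ∷ [] ∷ []
noDoubleZeroWords-unique (suc (suc n)) =
  Unique.++⁺ (Unique.map⁺ ∷-injectiveʳ (noDoubleZeroWords-unique (suc n)))
             (Unique.map⁺ (λ e → ∷-injectiveʳ (∷-injectiveʳ e)) (noDoubleZeroWords-unique n))
             disjoint
  where
  disjoint : ∀ {v} → ¬ (v ∈ map (true ∷_) (noDoubleZeroWords (suc n))
                        × v ∈ map (λ u → false ∷ true ∷ u) (noDoubleZeroWords n))
  disjoint (m₁ , m₀₁) with ∈-map⁻ (true ∷_) m₁ | ∈-map⁻ (λ u → false ∷ true ∷ u) m₀₁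
  ... | _ , _ , refl | _ , _ , ()

length-noDoubleZeroWords : (n : ℕ) → length (noDoubleZeroWords n) ≡ fib (n + 2)
length-noDoubleZeroWords 0 = refl
length-noDoubleZeroWords 1 = refl
length-noDoubleZeroWords (suc (suc n)) =
  trans (length-++ (map (true ∷_) (noDoubleZeroWords (suc n))))
        (cong₂ _+_ (trans (length-map _ (noDoubleZeroWords (suc n))) (length-noDoubleZeroWords (suc n)))
                   (trans (length-map _ (noDoubleZeroWords n)) (length-noDoubleZeroWords n)))

proposition4 : (c : ℕ) → c ≥ 1 →
    ((w : Word) → length w ≡ c → ((¬ IsCode (seq-1-01 w)) ⇔ NoDoubleZero w))
    × Σ (List Word) (λ L → Unique L
    × ((w : Word) → (w ∈ L) ⇔ (length w ≡ c × ¬ IsCode (seq-1-01 w)))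
    × length L ≡ fib (c + 2))
proposition4 c _ =
  (λ w _ → ¬IsCode⇔NoDoubleZero w) ,
  noDoubleZeroWords c , noDoubleZeroWords-unique c , membership , length-noDoubleZeroWords c
  where
  membership : (w : Word) → (w ∈ noDoubleZeroWords c) ⇔ (length w ≡ c × ¬ IsCode (seq-1-01 w))
  membership w = mk⇔
    (λ m → map₂ (Equivalence.from (¬IsCode⇔NoDoubleZero w)) (Equivalence.to (∈-noDoubleZeroWords⇔ c w) m))
    (λ h → Equivalence.from (∈-noDoubleZeroWords⇔ c w) (map₂ (Equivalence.to (¬IsCode⇔NoDoubleZero w)) h))
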